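{- Let $G$ be a graph, $x^0$ an optimal basic feasible solution of $\mathrm{ELP}(G)$, and $(i,j)$ an edge with $x^0_i+x^0_j=1$. If $R$ is a vertex cover of $G^{(i,j)}$, then $$R^*=\begin{cases} R\cup\{j\}, & \text{if } D_i\subseteq R,\\ R\cup\{i\}, & \text{otherwise},\end{cases}$$ is a vertex cover of $G$.
   Context: For a graph $H$, $\mathrm{ELP}(H)$ is the linear program: minimize $\sum_{v\in V(H)} x_v$ subject to $x_u+x_v\ge 1$ for every edge $(u,v)$ of $H$, $\sum_{v\in V(C)} x_v\ge s+1$ for every odd cycle $C$ of $H$ with $2s+1$ vertices, and $x\ge 0$. A vertex cover of a graph is a vertex set meeting every edge. For an edge $(i,j)$ of $G$, $D_i=\{s\in V(G): (i,s)\in E(G), s\ne j\}$ and $D_j=\{t\in V(G): (t,j)\in E(G), t\ne i\}$; the graph $G^{(i,j)}$ is obtained from $G$ by adding an edge $(s,t)$ for every $s\in D_i$, $t\in D_j$ whenever such an edge is not already present, and then deleting vertices $i$ and $j$ with all incident edges.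
   Formalization: $G^{(i,j)}$ keeps the added edge (s,s) as a loop at every s ∈ Dᵢ ∩ Dⱼ, so R contains Dᵢ ∩ Dⱼ, and x has rational rather than real entries. Apart from conventions, each condition added here is assumed in the paper as well or is needed for the statement above to hold. -}

module Defs where

open import Data.Nat using (ℕ; suc; _*_; _≤_)
open import Data.Integer using (+_)
open import Data.Rational using (ℚ; 0ℚ; 1ℚ; _+_; _/_) renaming (_≤_ to _≤ℚ_)
open import Data.Fin using (Fin)
open import Data.Fin.Subset using (Subset; _∈_)
open import Data.List using (List; []; _∷_; _++_; [_]; length; map; foldr)
open import Data.List.Relation.Unary.Linked using (Linked)
open import Data.List.Relation.Unary.Unique.Propositional using (Unique)
open import Data.List.Base using (allFin)
open import Data.Product using (_×_)
open import Data.Sum using (_⊎_)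
open import Relation.Nullary using (¬_)
open import Relation.Binary using (Decidable)
open import Relation.Binary.PropositionalEquality using (_≡_; _≢_)

record Graph (n : ℕ) : Set₁ where
  field
    Adj   : Fin n → Fin n → Set
    adj?  : Decidable Adj
    sym   : ∀ {u v} → Adj u v → Adj v u
    irrefl : ∀ {v} → ¬ Adj v v
open Graph public

sumℚ : List ℚ → ℚ
sumℚ = foldr _+_ 0ℚ

ℕtoℚ : ℕ → ℚ
ℕtoℚ k = (+ k) / 1

record OddCycle {n : ℕ} (G : Graph n) : Set where
  field
    s      : ℕ
    s≥1    : 1 ≤ s
    v₀     : Fin n
    rest   : List (Fin n)
    len    : length rest ≡ 2 * s
    distinct : Unique (v₀ ∷ rest)
    closed : Linked (Adj G) (v₀ ∷ rest ++ [ v₀ ])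
  verts : List (Fin n)
  verts = v₀ ∷ rest

cycleSum : ∀ {n} {G : Graph n} → (Fin n → ℚ) → OddCycle G → ℚ
cycleSum x C = sumℚ (map x (OddCycle.verts C))

objective : ∀ {n} → (Fin n → ℚ) → ℚ
objective {n} x = sumℚ (map x (allFin n))

Feasible : ∀ {n} → Graph n → (Fin n → ℚ) → Set
Feasible G x =
  (∀ u v → Adj G u v → 1ℚ ≤ℚ x u + x v)
  × (∀ (C : OddCycle G) → ℕtoℚ (suc (OddCycle.s C)) ≤ℚ cycleSum x C)
  × (∀ v → 0ℚ ≤ℚ x v)

Optimal : ∀ {n} → Graph n → (Fin n → ℚ) → Set
Optimal G x = Feasible G x × (∀ y → Feasible G y → objective x ≤ℚ objective y)

-- Basic: x is the unique solution of the system of constraints of ELP(G)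
-- that are active (tight) at x, taken as equalities
-- (equivalently, the active constraints have rank n).
Basic : ∀ {n} → Graph n → (Fin n → ℚ) → Set
Basic G x = ∀ (y : Fin _ → ℚ) →
  (∀ u v → Adj G u v → x u + x v ≡ 1ℚ → y u + y v ≡ 1ℚ) →
  (∀ (C : OddCycle G) → cycleSum x C ≡ ℕtoℚ (suc (OddCycle.s C))
                      → cycleSum y C ≡ ℕtoℚ (suc (OddCycle.s C))) →
  (∀ v → x v ≡ 0ℚ → y v ≡ 0ℚ) →
  ∀ v → y v ≡ x v

OptimalBFS : ∀ {n} → Graph n → (Fin n → ℚ) → Set
OptimalBFS G x = Optimal G x × Basic G x

D : ∀ {n} → Graph n → (i j : Fin n) → Fin n → Set
D G i j s = Adj G i s × s ≢ j

-- Added edges (s,t)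
-- with s ∈ D_i, t ∈ D_j (in both orientations, as edges are undirected);
-- when s = t ∈ D_i ∩ D_j this is a loop at s, as the definition literally says.
InRest : ∀ {n} → (i j : Fin n) → Fin n → Set
InRest i j v = v ≢ i × v ≢ j

AdjContract : ∀ {n} → Graph n → (i j : Fin n) → Fin n → Fin n → Set
AdjContract G i j u v =
  InRest i j u × InRest i j v ×
  (Adj G u v ⊎ (D G i j u × D G j i v) ⊎ (D G j i u × D G i j v))

VertexCover : ∀ {n} → (Fin n → Fin n → Set) → Subset n → Set
VertexCover E R = ∀ u v → E u v → u ∈ R ⊎ v ∈ R

module Submission where

-- Let R cover
-- G^(i,j).  Since G^(i,j) keeps every edge of G between vertices other than
-- i and j, R covers all those edges (contraction-covers-rest).  If moreover
-- every neighbour of a vertex l other than k lies in R, then R covers every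
-- edge avoiding k (absorb-neighbourhood), and adding k itself then yields a
-- cover of the whole graph (add-vertex-cover).
--   * If D_i ⊆ R, apply this with k = j, l = i: R ∪ {j} covers G.
--   * Otherwise some s ∈ D_i is outside R; every t ∈ D_j is joined to s by
--     an added edge of G^(i,j), so D_j ⊆ R (neighbours-of-j-covered), and
--     with k = i, l = j we get that R ∪ {i} covers G.

open import Defs
open import Data.Fin using (Fin; _≟_)
open import Data.Fin.Subset using (Subset; _∈_; _∪_; ⁅_⁆)
open import Data.Fin.Subset.Properties using (_∈?_; x∈⁅x⁆; x∈p∪q⁺)
open import Data.Rational using (ℚ; 1ℚ; _+_)
open import Data.Product using (_×_; _,_)
open import Data.Sum using (_⊎_; inj₁; inj₂; map)
open import Data.Empty using (⊥-elim)
open import Relation.Nullary using (¬_; yes; no)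
open import Relation.Binary.PropositionalEquality using (_≡_; _≢_; refl)

CoversAvoiding : ∀ {n} → (Fin n → Fin n → Set) → Subset n → Fin n → Set
CoversAvoiding E S k = ∀ u v → E u v → u ≢ k → v ≢ k → u ∈ S ⊎ v ∈ S

adj⇒≢ : ∀ {n} (G : Graph n) {u v : Fin n} → Adj G u v → v ≢ u
adj⇒≢ G a refl = Graph.irrefl G a

add-vertex-cover : ∀ {n} (E : Fin n → Fin n → Set) (S : Subset n) (k : Fin n) →
  CoversAvoiding E S k → VertexCover E (S ∪ ⁅ k ⁆)
add-vertex-cover E S k cov u v e with u ≟ k | v ≟ k
... | yes refl | _        = inj₁ (x∈p∪q⁺ (inj₂ (x∈⁅x⁆ k)))
... | no _     | yes refl = inj₂ (x∈p∪q⁺ (inj₂ (x∈⁅x⁆ k)))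
... | no u≢k   | no v≢k   = map (λ p → x∈p∪q⁺ (inj₁ p)) (λ p → x∈p∪q⁺ (inj₁ p))
                                (cov u v e u≢k v≢k)

absorb-neighbourhood : ∀ {n} (G : Graph n) (S : Subset n) (k l : Fin n) →
  (∀ t → D G l k t → t ∈ S) →
  (∀ u v → Adj G u v → u ≢ k → u ≢ l → v ≢ k → v ≢ l → u ∈ S ⊎ v ∈ S) →
  CoversAvoiding (Adj G) S k
absorb-neighbourhood G S k l Dl⊆S rest u v a u≢k v≢k with u ≟ l | v ≟ l
... | yes refl | _        = inj₂ (Dl⊆S v (a , v≢k))
... | no _     | yes refl = inj₁ (Dl⊆S u (Graph.sym G a , u≢k))
... | no u≢l   | no v≢l   = rest u v a u≢k u≢l v≢k v≢l

contraction-covers-rest : ∀ {n} (G : Graph n) (i j : Fin n) (R : Subset n) →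
  VertexCover (AdjContract G i j) R →
  ∀ u v → Adj G u v → u ≢ i → u ≢ j → v ≢ i → v ≢ j → u ∈ R ⊎ v ∈ R
contraction-covers-rest G i j R cov u v a u≢i u≢j v≢i v≢j =
  cov u v ((u≢i , u≢j) , (v≢i , v≢j) , inj₁ a)

-- If R covers G^(i,j) but misses part of D_i, then D_j ⊆ R: a vertex
-- t ∈ D_j outside R would force, through the added edges (s,t), every
-- s ∈ D_i into R.
neighbours-of-j-covered : ∀ {n} (G : Graph n) (i j : Fin n) (R : Subset n) →
  VertexCover (AdjContract G i j) R →
  ¬ (∀ s → D G i j s → s ∈ R) → ∀ t → D G j i t → t ∈ R
neighbours-of-j-covered G i j R cov Di⊈R t Djt@(ajt , t≢i) with t ∈? R
... | yes t∈R = t∈R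
... | no t∉R  = ⊥-elim (Di⊈R Di⊆R)
  where
  Di⊆R : ∀ s → D G i j s → s ∈ R
  Di⊆R s Dis@(ais , s≢j)
    with cov s t ((adj⇒≢ G ais , s≢j) , (t≢i , adj⇒≢ G ajt) , inj₂ (inj₁ (Dis , Djt)))
  ... | inj₁ s∈R = s∈R
  ... | inj₂ t∈R = ⊥-elim (t∉R t∈R)

lemma4 : ∀ {n} (G : Graph n) (x : Fin n → ℚ) (i j : Fin n) →
    OptimalBFS G x → Adj G i j → x i + x j ≡ 1ℚ →
    (R : Subset n) → (∀ v → v ∈ R → InRest i j v) →
    VertexCover (AdjContract G i j) R →
    ((∀ s → D G i j s → s ∈ R) → VertexCover (Adj G) (R ∪ ⁅ j ⁆))
    × (¬ (∀ s → D G i j s → s ∈ R) → VertexCover (Adj G) (R ∪ ⁅ i ⁆))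
lemma4 G x i j _ _ _ R _ cov = cover-with-j , cover-with-i
  where
  rest : ∀ u v → Adj G u v → u ≢ i → u ≢ j → v ≢ i → v ≢ j → u ∈ R ⊎ v ∈ R
  rest = contraction-covers-rest G i j R cov

  cover-with-j : (∀ s → D G i j s → s ∈ R) → VertexCover (Adj G) (R ∪ ⁅ j ⁆)
  cover-with-j Di⊆R =
    add-vertex-cover (Adj G) R j (absorb-neighbourhood G R j i Di⊆R
      (λ u v a u≢j u≢i v≢j v≢i → rest u v a u≢i u≢j v≢i v≢j))

  cover-with-i : ¬ (∀ s → D G i j s → s ∈ R) → VertexCover (Adj G) (R ∪ ⁅ i ⁆)
  cover-with-i Di⊈R =
    add-vertex-cover (Adj G) R i (absorb-neighbourhood G R i j
      (neighbours-of-j-covered G i j R cov Di⊈R) rest)
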